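{- Let $G$ be a directed acyclic graph (precedence graph). For any antichain $A$ of $G$, there exists a maximal antichain $A_{\max}$ such that $A\subseteq A_{\max}$ and $d(A)=d(A_{\max})$.
   Context: The partial order $\preceq$ on $V(G)$ is reachability in $G$. An antichain is a set of pairwise incomparable elements; it is maximal if it is not strictly contained in another antichain. $\mathrm{pred}(A)=\{x:\exists a\in A,\ x\preceq a\}$, $\mathrm{comp}(A)=\{x:\exists a\in A,\ x\preceq a\text{ or }x\succeq a\}$. For a DAG $H$, $\min(H)$ is its set of minimal elements, and $G-S$ is the subgraph induced on $V(G)\setminus S$. The depth of an antichain is $d(A)=|\mathrm{pred}(A)|+|\min(G-\mathrm{comp}(A))|$. -}

module Defs where

open import Data.Nat using (ℕ; zero; suc; _+_)
open import Data.Bool using (Bool; true; false; _∧_; _∨_; not; T)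
open import Data.Fin using (Fin; zero; suc; _≟_)
open import Data.Fin.Subset using (Subset; _∈_; _⊆_; ∣_∣)
open import Data.Vec using (lookup; tabulate)
open import Data.Empty using (⊥)
open import Data.Product using (_×_)
open import Relation.Nullary.Decidable using (⌊_⌋)
open import Relation.Binary.PropositionalEquality using (_≡_)

Graph : ℕ → Set
Graph n = Fin n → Fin n → Bool

anyFin : ∀ {n} → (Fin n → Bool) → Bool
anyFin {zero}  f = false
anyFin {suc n} f = f zero ∨ anyFin (λ i → f (suc i))

reachIn : ∀ {n} → ℕ → Graph n → Fin n → Fin n → Bool
reachIn zero    G x y = ⌊ x ≟ y ⌋
reachIn (suc k) G x y = reachIn k G x y ∨ anyFin (λ z → reachIn k G x z ∧ G z y)

-- Reachability (reflexive-transitive closure of the edge relation):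
-- on n vertices, any reachable vertex is reachable by a path of length ≤ n.
reach : ∀ {n} → Graph n → Fin n → Fin n → Bool
reach {n} G x y = reachIn n G x y

_⊢_⪯_ : ∀ {n} → Graph n → Fin n → Fin n → Set
G ⊢ x ⪯ y = T (reach G x y)

Acyclic : ∀ {n} → Graph n → Set
Acyclic {n} G = ∀ (x y : Fin n) → T (G x y) → G ⊢ y ⪯ x → ⊥

Antichain : ∀ {n} → Graph n → Subset n → Set
Antichain {n} G A = ∀ (x y : Fin n) → x ∈ A → y ∈ A → G ⊢ x ⪯ y → x ≡ y

MaximalAntichain : ∀ {n} → Graph n → Subset n → Set
MaximalAntichain {n} G A =
  Antichain G A × (∀ (B : Subset n) → Antichain G B → A ⊆ B → B ⊆ A)

predSet : ∀ {n} → Graph n → Subset n → Subset n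
predSet G A = tabulate (λ x → anyFin (λ a → lookup A a ∧ reach G x a))

compSet : ∀ {n} → Graph n → Subset n → Subset n
compSet G A =
  tabulate (λ x → anyFin (λ a → lookup A a ∧ (reach G x a ∨ reach G a x)))

-- G - S : the subgraph induced on V(G) \ S, presented as a graph on Fin n
-- whose edges are those of G with both ends outside S (vertices in S are
-- then excluded explicitly wherever the vertex set of G - S matters).
remove : ∀ {n} → Graph n → Subset n → Graph n
remove G S x y = not (lookup S x) ∧ not (lookup S y) ∧ G x y

minRemove : ∀ {n} → Graph n → Subset n → Subset n
minRemove G S = tabulate (λ x →
  not (lookup S x) ∧
  not (anyFin (λ y → not (lookup S y) ∧ not ⌊ y ≟ x ⌋ ∧ reach (remove G S) y x)))

depth : ∀ {n} → Graph n → Subset n → ℕ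
depth G A = ∣ predSet G A ∣ + ∣ minRemove G (compSet G A) ∣

-- Extend A by M = min(G − comp(A)). Every vertex outside comp(A) lies above
-- an element of M, since G − comp(A) is a finite DAG; hence comp(A ∪ M) is
-- everything, which makes A ∪ M a maximal antichain whose min-term in the
-- depth vanishes. On the other hand, an x below some m ∈ M either lies in
-- comp(A), and then below A, or equals m by minimality, because the
-- complement of comp(A) is convex and so paths between its vertices avoid
-- comp(A). Thus pred(A ∪ M) is the disjoint union of pred(A) and M, and the
-- depth is unchanged.
module Submission where

open import Defs
open import Data.Nat using (ℕ; zero; suc; _+_; _∸_; _≤_; _<_; z≤n; s≤s; s≤s⁻¹)
open import Data.Nat.Properties
  using (≤-trans; m≤m+n; m∸n+n≡m; m<n⇒m<1+n; n<1+n; <⇒≱; +-suc; +-identityʳ)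
open import Data.Nat.Induction using (<-wellFounded)
open import Data.Bool using (Bool; true; false; _∧_; not; T)
open import Data.Bool.Properties using (T-≡; T-∧; T-∨)
open import Data.Fin using (Fin; zero; suc; _≟_)
open import Data.Fin.Properties using (any?)
open import Data.Fin.Subset
  using (Subset; inside; outside; _∈_; _∉_; _⊆_; _⊂_; _∪_; _∩_; ⁅_⁆; ∣_∣; Empty)
open import Data.Fin.Subset.Properties
  using ( _∈?_; _⊂?_; ⊆-refl; ⊆-trans; ⊆-antisym; p⊂q⇒∣p∣<∣q∣; ∣p∣≤n; ∣⊥∣≡0
        ; drop-∷-Empty; Empty-unique; x∈⁅x⁆; x∈⁅y⁆⇒x≡y
        ; p⊆p∪q; q⊆p∪q; x∈p∪q⁻; x∈p∩q⁻)
open import Data.Vec using ([]; _∷_; here; lookup; tabulate)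
open import Data.Vec.Properties using ([]=⇒lookup; lookup⇒[]=; lookup∘tabulate)
open import Data.Empty using (⊥-elim)
open import Data.Product using (Σ; ∃-syntax; _×_; _,_; proj₁; proj₂)
open import Data.Sum using (_⊎_; inj₁; inj₂)
import Data.Sum as Sum
open import Function using (_∘_)
open import Function.Bundles using (Equivalence)
open import Induction.WellFounded using (Acc; acc)
open import Relation.Nullary using (¬_; yes; no; contradiction; ¬?)
open import Relation.Nullary.Decidable using (⌊_⌋; _×-dec_; T?; toWitness; fromWitness; decidable-stable)
open import Relation.Binary.PropositionalEquality
  using (_≡_; _≢_; refl; sym; trans; cong; subst; module ≡-Reasoning)
open import Relation.Binary.Construct.Closure.ReflexiveTransitive using (Star; ε; _◅_; _◅◅_)
import Relation.Binary.Construct.Closure.ReflexiveTransitive as Star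

open Equivalence using (to; from)

T-not⁺ : ∀ {b} → ¬ T b → T (not b)
T-not⁺ {false} _   = _
T-not⁺ {true}  ¬tt = ¬tt _

T-not⁻ : ∀ {b} → T (not b) → ¬ T b
T-not⁻ {false} _ ()

anyFin⁺ : ∀ {n} (f : Fin n → Bool) z → T (f z) → T (anyFin f)
anyFin⁺ f zero    fz = from T-∨ (inj₁ fz)
anyFin⁺ f (suc z) fz = from T-∨ (inj₂ (anyFin⁺ (f ∘ suc) z fz))

anyFin⁻ : ∀ {n} {f : Fin n → Bool} → T (anyFin f) → ∃[ z ] T (f z)
anyFin⁻ {suc n} {f} t with to T-∨ t
... | inj₁ f0 = zero , f0
... | inj₂ fs = let (z , fz) = anyFin⁻ fs in suc z , fz

module _ {n : ℕ} {p : Subset n} {x : Fin n} where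

  ∈⇒T-lookup : x ∈ p → T (lookup p x)
  ∈⇒T-lookup x∈p = from T-≡ ([]=⇒lookup x∈p)

  T-lookup⇒∈ : T (lookup p x) → x ∈ p
  T-lookup⇒∈ t = lookup⇒[]= x p (to T-≡ t)

  ∉⇒T-not-lookup : x ∉ p → T (not (lookup p x))
  ∉⇒T-not-lookup x∉p = T-not⁺ (x∉p ∘ T-lookup⇒∈)

  T-not-lookup⇒∉ : T (not (lookup p x)) → x ∉ p
  T-not-lookup⇒∉ t = T-not⁻ t ∘ ∈⇒T-lookup

module _ {n : ℕ} {f : Fin n → Bool} {x : Fin n} where

  ∈-tabulate⁺ : T (f x) → x ∈ tabulate f
  ∈-tabulate⁺ fx = T-lookup⇒∈ (subst T (sym (lookup∘tabulate f x)) fx)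

  ∈-tabulate⁻ : x ∈ tabulate f → T (f x)
  ∈-tabulate⁻ x∈ = subst T (lookup∘tabulate f x) (∈⇒T-lookup x∈)

∣p∪q∣≡∣p∣+∣q∣ : ∀ {n} {p q : Subset n} → Empty (p ∩ q) → ∣ p ∪ q ∣ ≡ ∣ p ∣ + ∣ q ∣
∣p∪q∣≡∣p∣+∣q∣ {p = []}          {[]}          _ = refl
∣p∪q∣≡∣p∣+∣q∣ {p = inside  ∷ p} {inside  ∷ q} e = contradiction (zero , here) e
∣p∪q∣≡∣p∣+∣q∣ {p = inside  ∷ p} {outside ∷ q} e = cong suc (∣p∪q∣≡∣p∣+∣q∣ (drop-∷-Empty e))
∣p∪q∣≡∣p∣+∣q∣ {p = outside ∷ p} {inside  ∷ q} e =
  trans (cong suc (∣p∪q∣≡∣p∣+∣q∣ (drop-∷-Empty e))) (sym (+-suc ∣ p ∣ ∣ q ∣))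
∣p∪q∣≡∣p∣+∣q∣ {p = outside ∷ p} {outside ∷ q} e = ∣p∪q∣≡∣p∣+∣q∣ (drop-∷-Empty e)

⊆∧¬⊂⇒⊇ : ∀ {n} {p q : Subset n} → p ⊆ q → ¬ p ⊂ q → q ⊆ p
⊆∧¬⊂⇒⊇ {p = p} p⊆q ¬p⊂q {x} x∈q with x ∈? p
... | yes x∈p = x∈p
... | no  x∉p = contradiction ((λ {y} → p⊆q {y}) , x , x∈q , x∉p) ¬p⊂q

-- A strictly increasing chain of subsets of Fin n has at most n + 1 members,
-- so the chain stops growing by step n; once it stops it stays put.
module StabilisingChain {n : ℕ} (S : ℕ → Subset n)
  (increasing : ∀ k → S k ⊆ S (suc k))
  (stable-propagates : ∀ k → S (suc k) ⊆ S k → S (suc (suc k)) ⊆ S (suc k))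
  where

  increasing-≤ : ∀ {j k} → j ≤ k → S j ⊆ S k
  increasing-≤ {j} {k} j≤k = subst (λ i → S j ⊆ S i) (m∸n+n≡m j≤k) (increasing-+ (k ∸ j))
    where
    increasing-+ : ∀ i → S j ⊆ S (i + j)
    increasing-+ zero    = ⊆-refl
    increasing-+ (suc i) = ⊆-trans (increasing-+ i) (increasing (i + j))

  stable-from : ∀ {j} → S (suc j) ⊆ S j → ∀ i → S (suc (i + j)) ⊆ S (i + j)
  stable-from     st zero    = st
  stable-from {j} st (suc i) = stable-propagates (i + j) (stable-from st i)

  constant-from : ∀ {j} → S (suc j) ⊆ S j → ∀ i → S (i + j) ⊆ S j
  constant-from st zero    = ⊆-refl
  constant-from st (suc i) = ⊆-trans (stable-from st i) (constant-from st i)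

  grows-or-stabilises : ∀ k → k ≤ ∣ S k ∣ ⊎ ∃[ j ] (j < k × S (suc j) ⊆ S j)
  grows-or-stabilises zero = inj₁ z≤n
  grows-or-stabilises (suc k) with grows-or-stabilises k
  ... | inj₂ (j , j<k , st) = inj₂ (j , m<n⇒m<1+n j<k , st)
  ... | inj₁ k≤∣Sk∣ with S k ⊂? S (suc k)
  ...   | yes Sk⊂Sk+1 = inj₁ (≤-trans (s≤s k≤∣Sk∣) (p⊂q⇒∣p∣<∣q∣ Sk⊂Sk+1))
  ...   | no  Sk⊄Sk+1 = inj₂ (k , n<1+n k , ⊆∧¬⊂⇒⊇ (increasing k) Sk⊄Sk+1)

  ⊆-at-n : ∀ m → S m ⊆ S n
  ⊆-at-n m with grows-or-stabilises (suc n)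
  ... | inj₁ n<∣S∣ = contradiction (∣p∣≤n (S (suc n))) (<⇒≱ n<∣S∣)
  ... | inj₂ (j , j≤n , st) =
    ⊆-trans (increasing-≤ (m≤m+n m j)) (⊆-trans (constant-from st m) (increasing-≤ (s≤s⁻¹ j≤n)))

Reach : ∀ {n} → Graph n → Fin n → Fin n → Set
Reach H = Star (λ x y → T (H x y))

Minimal : ∀ {n} → Graph n → Fin n → Set
Minimal H m = ∀ {y} → Reach H y m → y ≡ m

Convex : ∀ {n} → Graph n → (Fin n → Set) → Set
Convex H P = ∀ {x w y} → P x → P y → Reach H x w → Reach H w y → P w

module _ {n : ℕ} (H : Graph n) where

  ReachInSuc : ℕ → Fin n → Fin n → Set
  ReachInSuc k x y = T (reachIn k H x y) ⊎ ∃[ z ] (T (reachIn k H x z) × T (H z y))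

  reachIn-suc⁻ : ∀ {k x y} → T (reachIn (suc k) H x y) → ReachInSuc k x y
  reachIn-suc⁻ {k} {x} {y} r with to (T-∨ {reachIn k H x y}) r
  ... | inj₁ r′ = inj₁ r′
  ... | inj₂ t  = let (z , q) = anyFin⁻ t in inj₂ (z , to (T-∧ {reachIn k H x z}) q)

  reachIn-suc⁺ : ∀ {k x y} → ReachInSuc k x y → T (reachIn (suc k) H x y)
  reachIn-suc⁺ {k} {x} {y} (inj₁ r) = from (T-∨ {reachIn k H x y}) (inj₁ r)
  reachIn-suc⁺ {k} {x} {y} (inj₂ (z , r , e)) =
    from (T-∨ {reachIn k H x y}) (inj₂ (anyFin⁺ (λ z → reachIn k H x z ∧ H z y) z (from T-∧ (r , e))))

  reachIn⇒Reach : ∀ k {x y} → T (reachIn k H x y) → Reach H x y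
  reachIn⇒Reach zero {x} {y} r with toWitness {a? = x ≟ y} r
  ... | refl = ε
  reachIn⇒Reach (suc k) {x} {y} r with reachIn-suc⁻ {k} {x} {y} r
  ... | inj₁ r′           = reachIn⇒Reach k r′
  ... | inj₂ (z , r′ , e) = reachIn⇒Reach k r′ ◅◅ (e ◅ ε)

  reachIn-cons : ∀ k {x w y} → T (H x w) → T (reachIn k H w y) → T (reachIn (suc k) H x y)
  reachIn-cons zero {x} {w} {y} e r with toWitness {a? = w ≟ y} r
  ... | refl = reachIn-suc⁺ {0} {x} {y} (inj₂ (x , fromWitness {a? = x ≟ x} refl , e))
  reachIn-cons (suc k) {x} {w} {y} e r with reachIn-suc⁻ {k} {w} {y} r
  ... | inj₁ r′            = reachIn-suc⁺ {suc k} {x} {y} (inj₁ (reachIn-cons k e r′))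
  ... | inj₂ (z , r′ , e′) = reachIn-suc⁺ {suc k} {x} {y} (inj₂ (z , reachIn-cons k e r′ , e′))

  Reach⇒reachIn : ∀ {x y} → Reach H x y → ∃[ k ] T (reachIn k H x y)
  Reach⇒reachIn {x} ε       = 0 , fromWitness {a? = x ≟ x} refl
  Reach⇒reachIn (e ◅ x⇝y) = let (k , r) = Reach⇒reachIn x⇝y in suc k , reachIn-cons k e r

  -- The vertices reachable from x within k steps form a chain in k that
  -- stabilises, so reachability within n steps is the same as reachability.
  reachIn⇒⪯ : ∀ k {x y} → T (reachIn k H x y) → H ⊢ x ⪯ y
  reachIn⇒⪯ k {x} r =
    ∈-tabulate⁻ (StabilisingChain.⊆-at-n within increasing stable-propagates k (∈-tabulate⁺ r))
    where
    within : ℕ → Subset n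
    within k = tabulate (reachIn k H x)

    increasing : ∀ k → within k ⊆ within (suc k)
    increasing k {y} y∈ = ∈-tabulate⁺ (reachIn-suc⁺ {k} {x} {y} (inj₁ (∈-tabulate⁻ y∈)))

    stable-propagates : ∀ k → within (suc k) ⊆ within k → within (suc (suc k)) ⊆ within (suc k)
    stable-propagates k st {y} y∈ with reachIn-suc⁻ {suc k} {x} {y} (∈-tabulate⁻ y∈)
    ... | inj₁ r′           = ∈-tabulate⁺ r′
    ... | inj₂ (z , r′ , e) =
      let r″ = ∈-tabulate⁻ (st (∈-tabulate⁺ {f = reachIn (suc k) H x} r′)) in
      ∈-tabulate⁺ (reachIn-suc⁺ {k} {x} {y} (inj₂ (z , r″ , e)))

  ⪯⇒Reach : ∀ {x y} → H ⊢ x ⪯ y → Reach H x y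
  ⪯⇒Reach = reachIn⇒Reach n

  Reach⇒⪯ : ∀ {x y} → Reach H x y → H ⊢ x ⪯ y
  Reach⇒⪯ x⇝y = let (k , r) = Reach⇒reachIn x⇝y in reachIn⇒⪯ k r

  Reach-antisym : Acyclic H → ∀ {x y} → Reach H x y → Reach H y x → x ≡ y
  Reach-antisym acyclic ε         _   = refl
  Reach-antisym acyclic (e ◅ w⇝y) y⇝x = ⊥-elim (acyclic _ _ e (Reach⇒⪯ (w⇝y ◅◅ y⇝x)))

  Comparable : Fin n → Fin n → Set
  Comparable x a = Reach H x a ⊎ Reach H a x

  ∈predSet⁺ : ∀ S {x a} → a ∈ S → Reach H x a → x ∈ predSet H S
  ∈predSet⁺ S {a = a} a∈S x⇝a =
    ∈-tabulate⁺ (anyFin⁺ _ a (from T-∧ (∈⇒T-lookup a∈S , Reach⇒⪯ x⇝a)))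

  ∈predSet⁻ : ∀ S {x} → x ∈ predSet H S → ∃[ a ] (a ∈ S × Reach H x a)
  ∈predSet⁻ S x∈ =
    let (a , q) = anyFin⁻ (∈-tabulate⁻ x∈) ; (a∈S , x⪯a) = to (T-∧ {lookup S a}) q in
    a , T-lookup⇒∈ a∈S , ⪯⇒Reach x⪯a

  ∈compSet⁺ : ∀ S {x a} → a ∈ S → Comparable x a → x ∈ compSet H S
  ∈compSet⁺ S {a = a} a∈S x~a = ∈-tabulate⁺ (anyFin⁺ _ a
    (from T-∧ (∈⇒T-lookup a∈S , from T-∨ (Sum.map Reach⇒⪯ Reach⇒⪯ x~a))))

  ∈compSet⁻ : ∀ S {x} → x ∈ compSet H S → ∃[ a ] (a ∈ S × Comparable x a)
  ∈compSet⁻ S {x} x∈ =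
    let (a , q) = anyFin⁻ (∈-tabulate⁻ x∈) ; (a∈S , x~a) = to (T-∧ {lookup S a}) q in
    a , T-lookup⇒∈ a∈S , Sum.map ⪯⇒Reach ⪯⇒Reach (to (T-∨ {reach H x a}) x~a)

  comp-full⇒maximal : ∀ {S} → Antichain H S → (∀ x → x ∈ compSet H S) → MaximalAntichain H S
  comp-full⇒maximal {S} antichain full = antichain , absorbed
    where
    absorbed : ∀ B → Antichain H B → S ⊆ B → B ⊆ S
    absorbed B antichainB S⊆B {x} x∈B with ∈compSet⁻ S (full x)
    ... | a , a∈S , inj₁ x⇝a = subst (_∈ S) (sym (antichainB x a x∈B (S⊆B a∈S) (Reach⇒⪯ x⇝a))) a∈S
    ... | a , a∈S , inj₂ a⇝x = subst (_∈ S) (antichainB a x (S⊆B a∈S) x∈B (Reach⇒⪯ a⇝x)) a∈S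

  compSet-complement-convex : ∀ S → Convex H (_∉ compSet H S)
  compSet-complement-convex S x∉C y∉C x⇝w w⇝y w∈C with ∈compSet⁻ S w∈C
  ... | a , a∈S , inj₁ w⇝a = x∉C (∈compSet⁺ S a∈S (inj₁ (x⇝w ◅◅ w⇝a)))
  ... | a , a∈S , inj₂ a⇝w = y∉C (∈compSet⁺ S a∈S (inj₂ (a⇝w ◅◅ w⇝y)))

  minimal-below : Acyclic H → ∀ x → ∃[ m ] (Minimal H m × Reach H m x)
  minimal-below acyclic x = descend x (<-wellFounded ∣ predSet H ⁅ x ⁆ ∣)
    where
    below-singleton : ∀ {y z} → z ∈ predSet H ⁅ y ⁆ → Reach H z y
    below-singleton {y} z∈ = let (a , a∈⁅y⁆ , z⇝a) = ∈predSet⁻ ⁅ y ⁆ z∈ in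
      subst (Reach H _) (x∈⁅y⁆⇒x≡y y a∈⁅y⁆) z⇝a

    below-shrinks : ∀ {y x} → Reach H y x → y ≢ x → ∣ predSet H ⁅ y ⁆ ∣ < ∣ predSet H ⁅ x ⁆ ∣
    below-shrinks {y} {x} y⇝x y≢x = p⊂q⇒∣p∣<∣q∣
      ( (λ z∈ → ∈predSet⁺ ⁅ x ⁆ (x∈⁅x⁆ x) (below-singleton z∈ ◅◅ y⇝x))
      , x , ∈predSet⁺ ⁅ x ⁆ (x∈⁅x⁆ x) ε
      , λ x∈ → y≢x (Reach-antisym acyclic y⇝x (below-singleton x∈)) )

    descend : ∀ x → Acc _<_ ∣ predSet H ⁅ x ⁆ ∣ → ∃[ m ] (Minimal H m × Reach H m x)
    descend x (acc rs) with any? (λ y → ¬? (y ≟ x) ×-dec T? (reach H y x))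
    ... | yes (y , y≢x , y⪯x) =
      let (m , minimal , m⇝y) = descend y (rs (below-shrinks (⪯⇒Reach y⪯x) y≢x)) in
      m , minimal , m⇝y ◅◅ ⪯⇒Reach y⪯x
    ... | no none-below = x , minimal , ε
      where
      minimal : Minimal H x
      minimal {y} y⇝x = decidable-stable (y ≟ x) (λ y≢x → none-below (y , y≢x , Reach⇒⪯ y⇝x))

module _ {n : ℕ} (H : Graph n) (S : Subset n) where

  remove-edge⁺ : ∀ {x y} → x ∉ S → y ∉ S → T (H x y) → T (remove H S x y)
  remove-edge⁺ x∉S y∉S e = from T-∧ (∉⇒T-not-lookup x∉S , from T-∧ (∉⇒T-not-lookup y∉S , e))

  remove-edge⁻ : ∀ {x y} → T (remove H S x y) → x ∉ S × y ∉ S × T (H x y)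
  remove-edge⁻ {x} {y} e =
    let (x∉S , e′) = to (T-∧ {not (lookup S x)}) e ; (y∉S , e″) = to (T-∧ {not (lookup S y)}) e′ in
    T-not-lookup⇒∉ x∉S , T-not-lookup⇒∉ y∉S , e″

  Reach-remove⇒Reach : ∀ {x y} → Reach (remove H S) x y → Reach H x y
  Reach-remove⇒Reach = Star.map (proj₂ ∘ proj₂ ∘ remove-edge⁻)

  Reach-remove-∉ : ∀ {x y} → Reach (remove H S) x y → y ∉ S → x ∉ S
  Reach-remove-∉ ε       y∉S = y∉S
  Reach-remove-∉ (e ◅ _) _   = proj₁ (remove-edge⁻ e)

  remove-acyclic : Acyclic H → Acyclic (remove H S)
  remove-acyclic acyclic x y e y⪯x =
    acyclic x y (proj₂ (proj₂ (remove-edge⁻ e)))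
      (Reach⇒⪯ H (Reach-remove⇒Reach (⪯⇒Reach (remove H S) y⪯x)))

  Reach⇒Reach-remove : Convex H (_∉ S) →
                       ∀ {x y} → x ∉ S → y ∉ S → Reach H x y → Reach (remove H S) x y
  Reach⇒Reach-remove convex x∉S y∉S ε         = ε
  Reach⇒Reach-remove convex x∉S y∉S (e ◅ w⇝y) =
    let w∉S = convex x∉S y∉S (e ◅ ε) w⇝y in
    remove-edge⁺ x∉S w∉S e ◅ Reach⇒Reach-remove convex w∉S y∉S w⇝y

  ∈minRemove⁺ : ∀ {x} → x ∉ S → Minimal (remove H S) x → x ∈ minRemove H S
  ∈minRemove⁺ {x} x∉S minimal =
    ∈-tabulate⁺ (from T-∧ (∉⇒T-not-lookup x∉S , T-not⁺ no-vertex-below))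
    where
    no-vertex-below : ¬ T (anyFin (λ y → not (lookup S y) ∧ not ⌊ y ≟ x ⌋ ∧ reach (remove H S) y x))
    no-vertex-below t =
      let (y , q) = anyFin⁻ t
          (_ , q′) = to (T-∧ {not (lookup S y)}) q
          (y≢x , y⪯x) = to (T-∧ {not ⌊ y ≟ x ⌋}) q′
      in T-not⁻ y≢x (fromWitness (minimal (⪯⇒Reach (remove H S) y⪯x)))

  ∈minRemove⁻ : ∀ {x} → x ∈ minRemove H S → x ∉ S × Minimal (remove H S) x
  ∈minRemove⁻ {x} x∈ = T-not-lookup⇒∉ outside-S , minimal
    where
    outside-S : T (not (lookup S x))
    outside-S = proj₁ (to (T-∧ {not (lookup S x)}) (∈-tabulate⁻ x∈))

    none-below : T (not (anyFin (λ y → not (lookup S y) ∧ not ⌊ y ≟ x ⌋ ∧ reach (remove H S) y x)))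
    none-below = proj₂ (to (T-∧ {not (lookup S x)}) (∈-tabulate⁻ x∈))

    minimal : Minimal (remove H S) x
    minimal {y} y⇝x = decidable-stable (y ≟ x) λ y≢x →
      T-not⁻ none-below (anyFin⁺ _ y (from T-∧
        ( ∉⇒T-not-lookup (Reach-remove-∉ y⇝x (T-not-lookup⇒∉ outside-S))
        , from T-∧ (T-not⁺ (y≢x ∘ toWitness) , Reach⇒⪯ (remove H S) y⇝x) )))

  minRemove-below : Acyclic H → ∀ {x} → x ∉ S → ∃[ m ] (m ∈ minRemove H S × Reach H m x)
  minRemove-below acyclic x∉S =
    let (m , minimal , m⇝x) = minimal-below (remove H S) (remove-acyclic acyclic) _ in
    m , ∈minRemove⁺ (Reach-remove-∉ m⇝x x∉S) minimal , Reach-remove⇒Reach m⇝x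

  ∣minRemove-full∣≡0 : (∀ x → x ∈ S) → ∣ minRemove H S ∣ ≡ 0
  ∣minRemove-full∣≡0 full =
    trans (cong ∣_∣ (Empty-unique λ (x , x∈) → proj₁ (∈minRemove⁻ x∈) (full x))) (∣⊥∣≡0 n)

module MinimalExtension {n : ℕ} {G : Graph n} (acyclic : Acyclic G)
                        {A : Subset n} (antichain : Antichain G A) where

  C : Subset n
  C = compSet G A

  M : Subset n
  M = minRemove G C

  M-outside-C : ∀ {m} → m ∈ M → m ∉ C
  M-outside-C = proj₁ ∘ ∈minRemove⁻ G C

  M-minimal : ∀ {m y} → m ∈ M → y ∉ C → Reach G y m → y ≡ m
  M-minimal m∈M y∉C y⇝m =
    proj₂ (∈minRemove⁻ G C m∈M)
      (Reach⇒Reach-remove G C (compSet-complement-convex G A) y∉C (M-outside-C m∈M) y⇝m)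

  A∪M-antichain : Antichain G (A ∪ M)
  A∪M-antichain x y x∈ y∈ x⪯y with x∈p∪q⁻ A M x∈ | x∈p∪q⁻ A M y∈
  ... | inj₁ x∈A | inj₁ y∈A = antichain x y x∈A y∈A x⪯y
  ... | inj₁ x∈A | inj₂ y∈M = ⊥-elim (M-outside-C y∈M (∈compSet⁺ G A x∈A (inj₂ (⪯⇒Reach G x⪯y))))
  ... | inj₂ x∈M | inj₁ y∈A = ⊥-elim (M-outside-C x∈M (∈compSet⁺ G A y∈A (inj₁ (⪯⇒Reach G x⪯y))))
  ... | inj₂ x∈M | inj₂ y∈M = M-minimal y∈M (M-outside-C x∈M) (⪯⇒Reach G x⪯y)

  compSet-A∪M-full : ∀ x → x ∈ compSet G (A ∪ M)
  compSet-A∪M-full x with x ∈? C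
  ... | yes x∈C = let (a , a∈A , x~a) = ∈compSet⁻ G A x∈C in
    ∈compSet⁺ G (A ∪ M) (p⊆p∪q M a∈A) x~a
  ... | no  x∉C = let (m , m∈M , m⇝x) = minRemove-below G C acyclic x∉C in
    ∈compSet⁺ G (A ∪ M) (q⊆p∪q A M m∈M) (inj₂ m⇝x)

  predSet-A∪M : predSet G (A ∪ M) ≡ predSet G A ∪ M
  predSet-A∪M = ⊆-antisym ⊆-split ⊇-split
    where
    below-M : ∀ {x m} → m ∈ M → Reach G x m → x ∈ predSet G A ∪ M
    below-M {x} m∈M x⇝m with x ∈? C
    ... | no x∉C = q⊆p∪q _ M (subst (_∈ M) (sym (M-minimal m∈M x∉C x⇝m)) m∈M)
    ... | yes x∈C with ∈compSet⁻ G A x∈C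
    ...   | a , a∈A , inj₁ x⇝a = p⊆p∪q M (∈predSet⁺ G A a∈A x⇝a)
    ...   | a , a∈A , inj₂ a⇝x =
      ⊥-elim (M-outside-C m∈M (∈compSet⁺ G A a∈A (inj₂ (a⇝x ◅◅ x⇝m))))

    ⊆-split : predSet G (A ∪ M) ⊆ predSet G A ∪ M
    ⊆-split x∈ with ∈predSet⁻ G (A ∪ M) x∈
    ... | a , a∈ , x⇝a with x∈p∪q⁻ A M a∈
    ...   | inj₁ a∈A = p⊆p∪q M (∈predSet⁺ G A a∈A x⇝a)
    ...   | inj₂ a∈M = below-M a∈M x⇝a

    ⊇-split : predSet G A ∪ M ⊆ predSet G (A ∪ M)
    ⊇-split x∈ with x∈p∪q⁻ (predSet G A) M x∈
    ... | inj₁ x∈predA = let (a , a∈A , x⇝a) = ∈predSet⁻ G A x∈predA in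
      ∈predSet⁺ G (A ∪ M) (p⊆p∪q M a∈A) x⇝a
    ... | inj₂ x∈M     = ∈predSet⁺ G (A ∪ M) (q⊆p∪q A M x∈M) ε

  predSet-A-disjoint-M : Empty (predSet G A ∩ M)
  predSet-A-disjoint-M (x , x∈) =
    let (x∈predA , x∈M) = x∈p∩q⁻ (predSet G A) M x∈
        (a , a∈A , x⇝a) = ∈predSet⁻ G A x∈predA
    in M-outside-C x∈M (∈compSet⁺ G A a∈A (inj₁ x⇝a))

  depth-A∪M : depth G A ≡ depth G (A ∪ M)
  depth-A∪M = begin
    ∣ predSet G A ∣ + ∣ M ∣     ≡⟨ ∣p∪q∣≡∣p∣+∣q∣ predSet-A-disjoint-M ⟨
    ∣ predSet G A ∪ M ∣         ≡⟨ cong ∣_∣ predSet-A∪M ⟨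
    ∣ predSet G (A ∪ M) ∣       ≡⟨ +-identityʳ _ ⟨
    ∣ predSet G (A ∪ M) ∣ + 0   ≡⟨ cong (∣ predSet G (A ∪ M) ∣ +_) no-minimal-vertex-left ⟨
    depth G (A ∪ M)             ∎
    where
    open ≡-Reasoning
    no-minimal-vertex-left : ∣ minRemove G (compSet G (A ∪ M)) ∣ ≡ 0
    no-minimal-vertex-left = ∣minRemove-full∣≡0 G (compSet G (A ∪ M)) compSet-A∪M-full

lemma19 : (n : ℕ) (G : Graph n) → Acyclic G →
    (A : Subset n) → Antichain G A →
    Σ (Subset n) (λ Amax → MaximalAntichain G Amax × A ⊆ Amax × depth G A ≡ depth G Amax)
lemma19 n G acyclic A antichain =
  A ∪ M , comp-full⇒maximal G A∪M-antichain compSet-A∪M-full , p⊆p∪q M , depth-A∪M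
  where open MinimalExtension acyclic antichain
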